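{- Let $p>5$ be a prime and $r,m$ positive integers. Then \[ \sum_{\substack{i_{1}+\cdots+i_{5}=mp^{r}\\ i_{1},\dots,i_{5}\in \mathcal{P}_{p}}}\frac{1}{i_{1}i_{2}i_{3}i_{4}i_{5}}=\frac{120}{mp^{r}}\sum_{\substack{1\leq u_{1}< u_{2}< u_{3}< u_{4}\leq mp^{r}\\ u_{1},\ u_{4},\ u_{2}-u_{1},\ u_{3}-u_{2},\ u_{4}-u_{3}\in \mathcal{P}_{p}}}\frac{1}{u_{1}u_{2}u_{3}u_{4}}. \]
   Context: $\mathcal{P}_{n}$ denotes the set of positive integers coprime to $n$; the left sum runs over ordered 5-tuples of positive integers, each coprime to $p$, summing to $mp^r$; the right sum runs over integer quadruples $1\le u_1<u_2<u_3<u_4\le mp^r$ with $u_1$, $u_4$, $u_2-u_1$, $u_3-u_2$, $u_4-u_3$ all coprime to $p$. -}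

module Defs where

open import Data.Nat using (ℕ; zero; suc; _+_; _*_; _∸_; _^_; _<_; _<?_; _≟_)
open import Data.Integer using (+_)
open import Data.Rational using (ℚ; 0ℚ; _/_) renaming (_+_ to _+ℚ_; _*_ to _*ℚ_)
open import Data.Nat.Coprimality using (Coprime; coprime?)
open import Data.Product using (_×_)
open import Relation.Nullary using (Dec; yes; no)
open import Relation.Nullary.Decidable using (_×-dec_)

sumTo : ℕ → (ℕ → ℚ) → ℚ
sumTo zero    f = 0ℚ
sumTo (suc n) f = sumTo n f +ℚ f (suc n)

[_]⇒_ : {P : Set} → Dec P → ℚ → ℚ
[ yes _ ]⇒ q = q
[ no  _ ]⇒ q = 0ℚ

-- 1/n as a rational (only ever applied to positive n; 1/0 := 0 is a junk value)
inv : ℕ → ℚ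
inv zero    = 0ℚ
inv (suc k) = + 1 / suc k

-- membership in 𝒫_n : coprime to n
inP : ℕ → ℕ → Set
inP n i = Coprime i n

inP? : ∀ n i → Dec (inP n i)
inP? n i = coprime? i n

-- Left-hand side: sum over ordered 5-tuples of positive integers in 𝒫_p
-- with i1+…+i5 = N of 1/(i1 i2 i3 i4 i5).  (Each i_k ≤ N automatically.)
lhs : ℕ → ℕ → ℚ
lhs p N =
  sumTo N λ i1 → sumTo N λ i2 → sumTo N λ i3 → sumTo N λ i4 → sumTo N λ i5 →
    [ ((i1 + i2 + i3 + i4 + i5) ≟ N)
        ×-dec (inP? p i1 ×-dec (inP? p i2 ×-dec (inP? p i3 ×-dec (inP? p i4 ×-dec inP? p i5)))) ]⇒
      inv (i1 * i2 * i3 * i4 * i5)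

rhsSum : ℕ → ℕ → ℚ
rhsSum p N =
  sumTo N λ u1 → sumTo N λ u2 → sumTo N λ u3 → sumTo N λ u4 →
    [ (u1 <? u2) ×-dec ((u2 <? u3) ×-dec ((u3 <? u4) ×-dec
        (inP? p u1 ×-dec (inP? p u4 ×-dec (inP? p (u2 ∸ u1) ×-dec
          (inP? p (u3 ∸ u2) ×-dec inP? p (u4 ∸ u3))))))) ]⇒
      inv (u1 * u2 * u3 * u4)

-- Write e i = [i ∈ 𝒫_p] and w i = e i / i.  The left-hand side is the fifth
-- convolution power w^{*5}(N).  The key fact is the size identity: multiplying
-- w^{*(k+1)}(s) by s = i₁ + ⋯ + i_{k+1} and using the symmetry of the parts,
--   s · w^{*(k+1)}(s) = (k+1) · Σ_i e i · w^{*k}(s - i).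
-- Iterating it, and reindexing each step by v = u - i so that the parts become
-- the gaps of an increasing chain u₁ < u₂ < ⋯, expresses w^{*(k+1)}(u) as
-- (k+1)! times an iterated chain sum (power≡chain).  For k = 4 and u = N the
-- outermost gap N - u₄ lies in 𝒫_p exactly when u₄ does, because p ∣ N; this
-- identifies the chain sum with 1/N times the right-hand sum (chain-top≡rhs).
module Submission where

open import Defs
open import Data.Nat as ℕ using (ℕ; zero; suc; _+_; _*_; _∸_; _^_; _<_; _≤_; _≤?_; _<?_; _≟_; _!; z≤n; s≤s)
import Data.Nat.Properties as ℕP
open import Data.Nat.Primality using (Prime)
open import Data.Nat.Divisibility using (_∣_; ∣-refl; ∣-trans; ∣m+n∣m⇒∣n; ∣n⇒∣m*n; m∣m*n)
open import Data.Nat.Coprimality as Coprimality using (Coprime)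
open import Data.Integer as ℤ using (+_)
import Data.Integer.Properties as ℤP
open import Data.Rational using (ℚ; 0ℚ; 1ℚ; _/_; mkℚ) renaming (_+_ to _+ℚ_; _*_ to _*ℚ_)
import Data.Rational.Properties as ℚP
open import Data.Rational.Solver using (module +-*-Solver)
open import Data.Empty using (⊥-elim)
open import Data.Sum using (inj₁; inj₂)
open import Data.Product using (_,_)
open import Relation.Nullary using (Dec; yes; no; ¬_)
open import Relation.Nullary.Decidable using (_×-dec_)
open import Relation.Binary.PropositionalEquality
open +-*-Solver using (solve; con; _:+_; _:*_; _:=_)

toℚ : ℕ → ℚ
toℚ n = + n / 1

-- toℚ n and inv (suc k) are already in lowest terms; this lets the
-- library's field laws for mkℚ-literals apply to them.
toℚ-normal : ∀ n → toℚ n ≡ mkℚ (+ n) 0 (Coprimality.sym (Coprimality.1-coprimeTo n))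
toℚ-normal n = ℚP.normalize-coprime (Coprimality.sym (Coprimality.1-coprimeTo n))

inv-normal : ∀ k → inv (suc k) ≡ mkℚ (+ 1) k (Coprimality.1-coprimeTo (suc k))
inv-normal k = ℚP.normalize-coprime (Coprimality.1-coprimeTo (suc k))

toℚ-+ : ∀ m n → toℚ (m + n) ≡ toℚ m +ℚ toℚ n
toℚ-+ m n = begin
  toℚ (m + n)                             ≡⟨ cong₂ (λ a b → (a ℤ.+ b) / 1)
                                               (sym (ℤP.*-identityʳ (+ m))) (sym (ℤP.*-identityʳ (+ n))) ⟩
  ((+ m ℤ.* + 1) ℤ.+ (+ n ℤ.* + 1)) / 1
                                          ≡⟨ sym (cong₂ _+ℚ_ (toℚ-normal m) (toℚ-normal n)) ⟩
  toℚ m +ℚ toℚ n                          ∎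
  where open ≡-Reasoning

toℚ-* : ∀ m n → toℚ (m * n) ≡ toℚ m *ℚ toℚ n
toℚ-* m n = trans (cong (_/ 1) (ℤP.pos-* m n)) (sym (cong₂ _*ℚ_ (toℚ-normal m) (toℚ-normal n)))

toℚ*inv : ∀ k → toℚ (suc k) *ℚ inv (suc k) ≡ 1ℚ
toℚ*inv k = trans (cong₂ _*ℚ_ (toℚ-normal (suc k)) (inv-normal k))
                  (ℚP.*-inverseʳ (mkℚ (+ suc k) 0 (Coprimality.sym (Coprimality.1-coprimeTo (suc k)))))

inverse-unique : ∀ x y z → x *ℚ y ≡ 1ℚ → x *ℚ z ≡ 1ℚ → y ≡ z
inverse-unique x y z xy=1 xz=1 = begin
  y                ≡⟨ sym (ℚP.*-identityʳ y) ⟩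
  y *ℚ 1ℚ          ≡⟨ cong (y *ℚ_) (sym xz=1) ⟩
  y *ℚ (x *ℚ z)    ≡⟨ solve 3 (λ X Y Z → Y :* (X :* Z) := (X :* Y) :* Z) refl x y z ⟩
  (x *ℚ y) *ℚ z    ≡⟨ cong (_*ℚ z) xy=1 ⟩
  1ℚ *ℚ z          ≡⟨ ℚP.*-identityˡ z ⟩
  z                ∎
  where open ≡-Reasoning

-- inv is multiplicative (also at 0, thanks to the junk value inv 0 = 0).
inv-* : ∀ m n → inv (m * n) ≡ inv m *ℚ inv n
inv-* zero    n       = sym (ℚP.*-zeroˡ (inv n))
inv-* (suc a) zero    = trans (cong inv (ℕP.*-zeroʳ a)) (sym (ℚP.*-zeroʳ (inv (suc a))))
inv-* (suc a) (suc b) =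
  inverse-unique (toℚ (suc a * suc b)) _ _ (toℚ*inv (b + a * suc b)) (begin
    toℚ (suc a * suc b) *ℚ (inv (suc a) *ℚ inv (suc b))
      ≡⟨ cong (_*ℚ (inv (suc a) *ℚ inv (suc b))) (toℚ-* (suc a) (suc b)) ⟩
    (toℚ (suc a) *ℚ toℚ (suc b)) *ℚ (inv (suc a) *ℚ inv (suc b))
      ≡⟨ solve 4 (λ A B IA IB → (A :* B) :* (IA :* IB) := (A :* IA) :* (B :* IB)) refl
           (toℚ (suc a)) (toℚ (suc b)) (inv (suc a)) (inv (suc b)) ⟩
    (toℚ (suc a) *ℚ inv (suc a)) *ℚ (toℚ (suc b) *ℚ inv (suc b))
      ≡⟨ cong₂ _*ℚ_ (toℚ*inv a) (toℚ*inv b) ⟩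
    1ℚ *ℚ 1ℚ
      ≡⟨ ℚP.*-identityˡ 1ℚ ⟩
    1ℚ ∎)
  where open ≡-Reasoning

inv-cancel : ∀ k x → inv (suc k) *ℚ (toℚ (suc k) *ℚ x) ≡ x
inv-cancel k x = begin
  inv (suc k) *ℚ (toℚ (suc k) *ℚ x) ≡⟨ sym (ℚP.*-assoc (inv (suc k)) (toℚ (suc k)) x) ⟩
  (inv (suc k) *ℚ toℚ (suc k)) *ℚ x ≡⟨ cong (_*ℚ x) (trans (ℚP.*-comm (inv (suc k)) (toℚ (suc k))) (toℚ*inv k)) ⟩
  1ℚ *ℚ x                           ≡⟨ ℚP.*-identityˡ x ⟩
  x                                 ∎
  where open ≡-Reasoning

𝟙 : {P : Set} → Dec P → ℚ
𝟙 P? = [ P? ]⇒ 1ℚ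

guard≡𝟙* : ∀ {P : Set} (P? : Dec P) q → [ P? ]⇒ q ≡ 𝟙 P? *ℚ q
guard≡𝟙* (yes _) q = sym (ℚP.*-identityˡ q)
guard≡𝟙* (no _)  q = sym (ℚP.*-zeroˡ q)

guard-× : ∀ {P R : Set} (P? : Dec P) (R? : Dec R) q → [ P? ×-dec R? ]⇒ q ≡ 𝟙 P? *ℚ [ R? ]⇒ q
guard-× (yes _) (yes _) q = sym (ℚP.*-identityˡ q)
guard-× (yes _) (no _)  q = sym (ℚP.*-identityˡ 0ℚ)
guard-× (no _)  R?      q = sym (ℚP.*-zeroˡ ([ R? ]⇒ q))

sum-cong : ∀ n {f g : ℕ → ℚ} → (∀ i → 0 < i → i ≤ n → f i ≡ g i) → sumTo n f ≡ sumTo n g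
sum-cong zero    f≡g = refl
sum-cong (suc n) f≡g =
  cong₂ _+ℚ_ (sum-cong n (λ i 0<i i≤n → f≡g i 0<i (ℕP.m≤n⇒m≤1+n i≤n))) (f≡g (suc n) (s≤s z≤n) ℕP.≤-refl)

sum-vanish : ∀ n (f : ℕ → ℚ) → (∀ i → 0 < i → i ≤ n → f i ≡ 0ℚ) → sumTo n f ≡ 0ℚ
sum-vanish n f f≡0 = trans (sum-cong n f≡0) (zeros n)
  where
  zeros : ∀ n → sumTo n (λ _ → 0ℚ) ≡ 0ℚ
  zeros zero    = refl
  zeros (suc n) = trans (ℚP.+-identityʳ _) (zeros n)

sum-+ : ∀ n (f g : ℕ → ℚ) → sumTo n (λ i → f i +ℚ g i) ≡ sumTo n f +ℚ sumTo n g
sum-+ zero    f g = sym (ℚP.+-identityˡ 0ℚ)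
sum-+ (suc n) f g = trans (cong (_+ℚ (f (suc n) +ℚ g (suc n))) (sum-+ n f g))
  (solve 4 (λ A B C D → (A :+ B) :+ (C :+ D) := (A :+ C) :+ (B :+ D)) refl
     (sumTo n f) (sumTo n g) (f (suc n)) (g (suc n)))

sum-scale : ∀ n a (f : ℕ → ℚ) → sumTo n (λ i → a *ℚ f i) ≡ a *ℚ sumTo n f
sum-scale zero    a f = sym (ℚP.*-zeroʳ a)
sum-scale (suc n) a f = trans (cong (_+ℚ (a *ℚ f (suc n))) (sum-scale n a f))
  (sym (ℚP.*-distribˡ-+ a (sumTo n f) (f (suc n))))

sum-swap : ∀ n m (f : ℕ → ℕ → ℚ) →
  sumTo n (λ i → sumTo m (λ j → f i j)) ≡ sumTo m (λ j → sumTo n (λ i → f i j))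
sum-swap zero    m f = sym (sum-vanish m _ (λ _ _ _ → refl))
sum-swap (suc n) m f = begin
  sumTo n (λ i → sumTo m (f i)) +ℚ sumTo m (f (suc n))
    ≡⟨ cong (_+ℚ sumTo m (f (suc n))) (sum-swap n m f) ⟩
  sumTo m (λ j → sumTo n (λ i → f i j)) +ℚ sumTo m (f (suc n))
    ≡⟨ sym (sum-+ m _ _) ⟩
  sumTo m (λ j → sumTo n (λ i → f i j) +ℚ f (suc n) j) ∎
  where open ≡-Reasoning

sum-extend : ∀ n m (f : ℕ → ℚ) → n ≤ m → (∀ i → n < i → i ≤ m → f i ≡ 0ℚ) → sumTo m f ≡ sumTo n f
sum-extend n zero    f z≤n f≡0 = refl
sum-extend n (suc m) f n≤1+m f≡0 with ℕP.m≤n⇒m<n∨m≡n n≤1+m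
... | inj₂ refl         = refl
... | inj₁ (s≤s n≤m)    =
  trans (cong₂ _+ℚ_ (sum-extend n m f n≤m (λ i n<i i≤m → f≡0 i n<i (ℕP.m≤n⇒m≤1+n i≤m)))
                    (f≡0 (suc m) (s≤s n≤m) ℕP.≤-refl))
        (ℚP.+-identityʳ _)

sum-initial : ∀ {P : ℕ → Set} (P? : ∀ i → Dec (P i)) n m (f : ℕ → ℚ) → n ≤ m →
  (∀ i → P i → i ≤ n) → (∀ i → 0 < i → i ≤ n → P i) →
  sumTo m (λ i → [ P? i ]⇒ f i) ≡ sumTo n f
sum-initial P? n m f n≤m P⇒≤ ≤⇒P = trans (sum-extend n m _ n≤m outside) (sum-cong n inside)
  where
  outside : ∀ i → n < i → i ≤ m → [ P? i ]⇒ f i ≡ 0ℚ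
  outside i n<i _ with P? i
  ... | yes Pi = ⊥-elim (ℕP.<⇒≱ n<i (P⇒≤ i Pi))
  ... | no _   = refl
  inside : ∀ i → 0 < i → i ≤ n → [ P? i ]⇒ f i ≡ f i
  inside i 0<i i≤n with P? i
  ... | yes _  = refl
  ... | no ¬Pi = ⊥-elim (¬Pi (≤⇒P i 0<i i≤n))

sum-front : ∀ n (f : ℕ → ℚ) → sumTo (suc n) f ≡ f 1 +ℚ sumTo n (λ j → f (suc j))
sum-front zero    f = trans (ℚP.+-identityˡ (f 1)) (sym (ℚP.+-identityʳ (f 1)))
sum-front (suc n) f = trans (cong (_+ℚ f (suc (suc n))) (sum-front n f)) (ℚP.+-assoc (f 1) _ _)

sum-reverse : ∀ n (f : ℕ → ℚ) → sumTo (suc n) (λ j → f (suc n ∸ j)) ≡ f 0 +ℚ sumTo n f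
sum-reverse zero    f = trans (ℚP.+-identityˡ (f 0)) (sym (ℚP.+-identityʳ (f 0)))
sum-reverse (suc n) f = begin
  sumTo (suc (suc n)) (λ j → f (suc (suc n) ∸ j))
    ≡⟨ sum-front (suc n) (λ j → f (suc (suc n) ∸ j)) ⟩
  f (suc n) +ℚ sumTo (suc n) (λ j → f (suc n ∸ j))
    ≡⟨ cong (f (suc n) +ℚ_) (sum-reverse n f) ⟩
  f (suc n) +ℚ (f 0 +ℚ sumTo n f)
    ≡⟨ solve 3 (λ A B S → A :+ (B :+ S) := B :+ (S :+ A)) refl (f (suc n)) (f 0) (sumTo n f) ⟩
  f 0 +ℚ sumTo (suc n) f ∎
  where open ≡-Reasoning

-- Two ways of decomposing s as i + j + rest: the order in which i and j
-- are split off from s does not matter.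
sum-exchange : ∀ s (a b F : ℕ → ℚ) →
  sumTo s (λ i → a i *ℚ sumTo (s ∸ i) (λ j → b j *ℚ F (s ∸ i ∸ j))) ≡
  sumTo s (λ j → b j *ℚ sumTo (s ∸ j) (λ i → a i *ℚ F (s ∸ j ∸ i)))
sum-exchange s a b F = begin
  sumTo s (λ i → a i *ℚ sumTo (s ∸ i) (λ j → b j *ℚ F (s ∸ i ∸ j)))
    ≡⟨ sum-cong s (λ i _ _ → cong (a i *ℚ_) (sym (restrict i (λ j → b j *ℚ F (s ∸ i ∸ j))))) ⟩
  sumTo s (λ i → a i *ℚ sumTo s (λ j → [ j ≤? s ∸ i ]⇒ (b j *ℚ F (s ∸ i ∸ j))))
    ≡⟨ sum-cong s (λ i _ _ → sym (sum-scale s (a i) _)) ⟩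
  sumTo s (λ i → sumTo s (λ j → a i *ℚ [ j ≤? s ∸ i ]⇒ (b j *ℚ F (s ∸ i ∸ j))))
    ≡⟨ sum-swap s s _ ⟩
  sumTo s (λ j → sumTo s (λ i → a i *ℚ [ j ≤? s ∸ i ]⇒ (b j *ℚ F (s ∸ i ∸ j))))
    ≡⟨ sum-cong s (λ j _ j≤s → sum-cong s (λ i _ i≤s → termwise i j i≤s j≤s)) ⟩
  sumTo s (λ j → sumTo s (λ i → b j *ℚ [ i ≤? s ∸ j ]⇒ (a i *ℚ F (s ∸ j ∸ i))))
    ≡⟨ sum-cong s (λ j _ _ → sum-scale s (b j) _) ⟩
  sumTo s (λ j → b j *ℚ sumTo s (λ i → [ i ≤? s ∸ j ]⇒ (a i *ℚ F (s ∸ j ∸ i))))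
    ≡⟨ sum-cong s (λ j _ _ → cong (b j *ℚ_) (restrict j (λ i → a i *ℚ F (s ∸ j ∸ i)))) ⟩
  sumTo s (λ j → b j *ℚ sumTo (s ∸ j) (λ i → a i *ℚ F (s ∸ j ∸ i))) ∎
  where
  open ≡-Reasoning
  restrict : ∀ i (f : ℕ → ℚ) → sumTo s (λ j → [ j ≤? s ∸ i ]⇒ f j) ≡ sumTo (s ∸ i) f
  restrict i f = sum-initial (λ j → j ≤? s ∸ i) (s ∸ i) s f (ℕP.m∸n≤m s i) (λ _ le → le) (λ _ _ le → le)
  swap-≤ : ∀ {i j} → i ≤ s → j ≤ s ∸ i → i ≤ s ∸ j
  swap-≤ {i} {j} i≤s j≤s-i = ℕP.m+n≤o⇒m≤o∸n i (subst (_≤ s) (ℕP.+-comm j i) (ℕP.m≤o∸n⇒m+n≤o j i≤s j≤s-i))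
  swap-∸ : ∀ i j → s ∸ i ∸ j ≡ s ∸ j ∸ i
  swap-∸ i j = trans (ℕP.∸-+-assoc s i j) (trans (cong (s ∸_) (ℕP.+-comm i j)) (sym (ℕP.∸-+-assoc s j i)))
  termwise : ∀ i j → i ≤ s → j ≤ s →
    a i *ℚ [ j ≤? s ∸ i ]⇒ (b j *ℚ F (s ∸ i ∸ j)) ≡ b j *ℚ [ i ≤? s ∸ j ]⇒ (a i *ℚ F (s ∸ j ∸ i))
  termwise i j i≤s j≤s with j ≤? s ∸ i | i ≤? s ∸ j
  ... | yes _        | yes _        = trans (cong (λ t → a i *ℚ (b j *ℚ F t)) (swap-∸ i j))
                                        (solve 3 (λ A B X → A :* (B :* X) := B :* (A :* X)) refl
                                           (a i) (b j) (F (s ∸ j ∸ i)))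
  ... | yes j≤s-i    | no i≰s-j     = ⊥-elim (i≰s-j (swap-≤ i≤s j≤s-i))
  ... | no j≰s-i     | yes i≤s-j    = ⊥-elim (j≰s-i (swap-≤ j≤s i≤s-j))
  ... | no _         | no _         = trans (ℚP.*-zeroʳ (a i)) (sym (ℚP.*-zeroʳ (b j)))

scale-into-sum : ∀ n x y (f : ℕ → ℚ) → x *ℚ (y *ℚ sumTo n f) ≡ sumTo n (λ i → x *ℚ (y *ℚ f i))
scale-into-sum n x y f = trans (cong (x *ℚ_) (sym (sum-scale n y f))) (sym (sum-scale n x _))

guard-into-sum : ∀ {P : Set} (P? : Dec P) n x y (f : ℕ → ℚ) →
  [ P? ]⇒ (x *ℚ (y *ℚ sumTo n f)) ≡ sumTo n (λ i → [ P? ]⇒ (x *ℚ y) *ℚ f i)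
guard-into-sum (yes _) n x y f = trans (sym (ℚP.*-assoc x y _)) (sym (sum-scale n (x *ℚ y) f))
guard-into-sum (no _)  n x y f = sym (sum-vanish n _ (λ i _ _ → ℚP.*-zeroˡ (f i)))

sum-reverse-order : ∀ N (f : ℕ → ℕ → ℕ → ℕ → ℚ) →
  sumTo N (λ a → sumTo N (λ b → sumTo N (λ c → sumTo N (λ d → f a b c d)))) ≡
  sumTo N (λ d → sumTo N (λ c → sumTo N (λ b → sumTo N (λ a → f a b c d))))
sum-reverse-order N f = begin
  _ ≡⟨ sum-swap N N (λ a b → sumTo N (λ c → sumTo N (λ d → f a b c d))) ⟩
  _ ≡⟨ sum-cong N (λ b _ _ → sum-swap N N (λ a c → sumTo N (λ d → f a b c d))) ⟩
  _ ≡⟨ sum-cong N (λ b _ _ → sum-cong N (λ c _ _ → sum-swap N N (λ a d → f a b c d))) ⟩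
  _ ≡⟨ sum-swap N N (λ b c → sumTo N (λ d → sumTo N (λ a → f a b c d))) ⟩
  _ ≡⟨ sum-cong N (λ c _ _ → sum-swap N N (λ b d → sumTo N (λ a → f a b c d))) ⟩
  _ ≡⟨ sum-swap N N (λ c d → sumTo N (λ b → sumTo N (λ a → f a b c d))) ⟩
  _ ∎
  where open ≡-Reasoning

-- Convolution powers of a weight w on the positive integers:
-- power k s = Σ_{i₁+⋯+i_k = s, i_j ≥ 1} w i₁ ⋯ w i_k.
module Convolution (w : ℕ → ℚ) where

  power : ℕ → ℕ → ℚ
  power zero    zero    = 1ℚ
  power zero    (suc _) = 0ℚ
  power (suc k) s       = sumTo s (λ i → w i *ℚ power k (s ∸ i))

  -- The same quantity as k nested sums over 1..N with the constraint
  -- checked at the innermost level; a is the running partial sum.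
  nested : ℕ → ℕ → ℕ → ℚ
  nested N zero    a = 𝟙 (a ≟ N)
  nested N (suc k) a = sumTo N (λ i → w i *ℚ nested N k (a + i))

  nested-overflow : ∀ N k a → N < a → nested N k a ≡ 0ℚ
  nested-overflow N zero a N<a with a ≟ N
  ... | yes refl = ⊥-elim (ℕP.<-irrefl refl N<a)
  ... | no _     = refl
  nested-overflow N (suc k) a N<a = sum-vanish N _ (λ i _ _ →
    trans (cong (w i *ℚ_) (nested-overflow N k (a + i) (ℕP.<-≤-trans N<a (ℕP.m≤m+n a i))))
          (ℚP.*-zeroʳ (w i)))

  nested≡power : ∀ N k a → a ≤ N → nested N k a ≡ power k (N ∸ a)
  nested≡power N zero a a≤N with a ≟ N | N ∸ a in N-a
  ... | yes refl | zero  = refl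
  ... | yes refl | suc _ = ⊥-elim (ℕP.0≢1+n (trans (sym (ℕP.n∸n≡0 a)) N-a))
  ... | no a≢N   | zero  = ⊥-elim (a≢N (ℕP.≤-antisym a≤N (ℕP.m∸n≡0⇒m≤n N-a)))
  ... | no _     | suc _ = refl
  nested≡power N (suc k) a a≤N = begin
    sumTo N (λ i → w i *ℚ nested N k (a + i))
      ≡⟨ sum-extend (N ∸ a) N _ (ℕP.m∸n≤m N a) overshoot ⟩
    sumTo (N ∸ a) (λ i → w i *ℚ nested N k (a + i))
      ≡⟨ sum-cong (N ∸ a) (λ i _ i≤N-a → cong (w i *ℚ_) (by-induction i i≤N-a)) ⟩
    sumTo (N ∸ a) (λ i → w i *ℚ power k (N ∸ a ∸ i)) ∎
    where
    open ≡-Reasoning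
    overshoot : ∀ i → N ∸ a < i → i ≤ N → w i *ℚ nested N k (a + i) ≡ 0ℚ
    overshoot i N-a<i _ = trans (cong (w i *ℚ_) (nested-overflow N k (a + i) N<a+i)) (ℚP.*-zeroʳ (w i))
      where
      N<a+i : N < a + i
      N<a+i = ℕP.≰⇒> (λ a+i≤N → ℕP.<⇒≱ N-a<i (ℕP.m+n≤o⇒m≤o∸n i (subst (_≤ N) (ℕP.+-comm a i) a+i≤N)))
    by-induction : ∀ i → i ≤ N ∸ a → nested N k (a + i) ≡ power k (N ∸ a ∸ i)
    by-induction i i≤N-a =
      trans (nested≡power N k (a + i) (subst (_≤ N) (ℕP.+-comm i a) (ℕP.m≤o∸n⇒m+n≤o i a≤N i≤N-a)))
            (cong (power k) (sym (ℕP.∸-+-assoc N a i)))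

  power-one : ∀ n → power 1 (suc n) ≡ w (suc n)
  power-one n = begin
    sumTo n (λ i → w i *ℚ power 0 (suc n ∸ i)) +ℚ w (suc n) *ℚ power 0 (suc n ∸ suc n)
      ≡⟨ cong₂ _+ℚ_ (sum-vanish n _ beforeLast) (cong (λ t → w (suc n) *ℚ power 0 t) (ℕP.n∸n≡0 n)) ⟩
    0ℚ +ℚ w (suc n) *ℚ 1ℚ
      ≡⟨ trans (ℚP.+-identityˡ _) (ℚP.*-identityʳ (w (suc n))) ⟩
    w (suc n) ∎
    where
    open ≡-Reasoning
    beforeLast : ∀ i → 0 < i → i ≤ n → w i *ℚ power 0 (suc n ∸ i) ≡ 0ℚ
    beforeLast i _ i≤n rewrite ℕP.+-∸-assoc 1 i≤n = ℚP.*-zeroʳ (w i)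

-- Convolution powers of a weight of the form w i = a i / i.  The factor
-- 1/i lets one trade the size s = i₁+⋯+i_k of a composition for the
-- number k of its parts.
module Harmonic (a : ℕ → ℚ) where

  w : ℕ → ℚ
  w i = a i *ℚ inv i

  open Convolution w public

  toℚ*w : ∀ i → 0 < i → toℚ i *ℚ w i ≡ a i
  toℚ*w (suc k) _ = begin
    toℚ (suc k) *ℚ (a (suc k) *ℚ inv (suc k))
      ≡⟨ solve 3 (λ N A I → N :* (A :* I) := A :* (N :* I)) refl (toℚ (suc k)) (a (suc k)) (inv (suc k)) ⟩
    a (suc k) *ℚ (toℚ (suc k) *ℚ inv (suc k))
      ≡⟨ cong (a (suc k) *ℚ_) (toℚ*inv k) ⟩
    a (suc k) *ℚ 1ℚ
      ≡⟨ ℚP.*-identityʳ (a (suc k)) ⟩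
    a (suc k) ∎
    where open ≡-Reasoning

  marked : ℕ → ℕ → ℚ
  marked k s = sumTo s (λ i → a i *ℚ power k (s ∸ i))

  toℚ*power-zero : ∀ s → toℚ s *ℚ power 0 s ≡ 0ℚ
  toℚ*power-zero zero    = ℚP.*-identityʳ 0ℚ
  toℚ*power-zero (suc s) = ℚP.*-zeroʳ (toℚ (suc s))

  -- Size identity: multiplying power (k+1) s by s = i₁ + ⋯ + i_{k+1} and
  -- distributing, each of the k+1 parts contributes marked k s (by symmetry
  -- of the convolution).  The part i₁ is split off and the rest is handled by
  -- size-rest, which is the same identity one level down.
  size-identity : ∀ k s → toℚ s *ℚ power (suc k) s ≡ toℚ (suc k) *ℚ marked k s
  size-rest     : ∀ k s → sumTo s (λ i → w i *ℚ (toℚ (s ∸ i) *ℚ power k (s ∸ i))) ≡ toℚ k *ℚ marked k s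

  size-rest zero s =
    trans (sum-vanish s _ (λ i _ _ → trans (cong (w i *ℚ_) (toℚ*power-zero (s ∸ i))) (ℚP.*-zeroʳ (w i))))
          (sym (ℚP.*-zeroˡ (marked 0 s)))
  size-rest (suc k) s = begin
    sumTo s (λ i → w i *ℚ (toℚ (s ∸ i) *ℚ power (suc k) (s ∸ i)))
      ≡⟨ sum-cong s (λ i _ _ → cong (w i *ℚ_) (size-identity k (s ∸ i))) ⟩
    sumTo s (λ i → w i *ℚ (toℚ (suc k) *ℚ marked k (s ∸ i)))
      ≡⟨ sum-cong s (λ i _ _ → solve 3 (λ A B X → A :* (B :* X) := B :* (A :* X)) refl
                                   (w i) (toℚ (suc k)) (marked k (s ∸ i))) ⟩
    sumTo s (λ i → toℚ (suc k) *ℚ (w i *ℚ marked k (s ∸ i)))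
      ≡⟨ sum-scale s (toℚ (suc k)) _ ⟩
    toℚ (suc k) *ℚ sumTo s (λ i → w i *ℚ marked k (s ∸ i))
      ≡⟨ cong (toℚ (suc k) *ℚ_) (sum-exchange s w a (power k)) ⟩
    toℚ (suc k) *ℚ marked (suc k) s ∎
    where open ≡-Reasoning

  size-identity k s = begin
    toℚ s *ℚ power (suc k) s
      ≡⟨ sym (sum-scale s (toℚ s) _) ⟩
    sumTo s (λ i → toℚ s *ℚ (w i *ℚ power k (s ∸ i)))
      ≡⟨ sum-cong s split ⟩
    sumTo s (λ i → a i *ℚ power k (s ∸ i) +ℚ w i *ℚ (toℚ (s ∸ i) *ℚ power k (s ∸ i)))
      ≡⟨ sum-+ s _ _ ⟩
    marked k s +ℚ sumTo s (λ i → w i *ℚ (toℚ (s ∸ i) *ℚ power k (s ∸ i)))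
      ≡⟨ cong (marked k s +ℚ_) (size-rest k s) ⟩
    marked k s +ℚ toℚ k *ℚ marked k s
      ≡⟨ solve 2 (λ K M → M :+ K :* M := (con 1ℚ :+ K) :* M) refl (toℚ k) (marked k s) ⟩
    (1ℚ +ℚ toℚ k) *ℚ marked k s
      ≡⟨ cong (_*ℚ marked k s) (sym (toℚ-+ 1 k)) ⟩
    toℚ (suc k) *ℚ marked k s ∎
    where
    open ≡-Reasoning
    -- s = i + (s - i), and i · w i = a i.
    split : ∀ i → 0 < i → i ≤ s →
      toℚ s *ℚ (w i *ℚ power k (s ∸ i)) ≡ a i *ℚ power k (s ∸ i) +ℚ w i *ℚ (toℚ (s ∸ i) *ℚ power k (s ∸ i))
    split i 0<i i≤s = begin
      toℚ s *ℚ (w i *ℚ power k (s ∸ i))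
        ≡⟨ cong (λ t → toℚ t *ℚ (w i *ℚ power k (s ∸ i))) (sym (ℕP.m+[n∸m]≡n i≤s)) ⟩
      toℚ (i + (s ∸ i)) *ℚ (w i *ℚ power k (s ∸ i))
        ≡⟨ cong (_*ℚ (w i *ℚ power k (s ∸ i))) (toℚ-+ i (s ∸ i)) ⟩
      (toℚ i +ℚ toℚ (s ∸ i)) *ℚ (w i *ℚ power k (s ∸ i))
        ≡⟨ solve 4 (λ I J W P → (I :+ J) :* (W :* P) := (I :* W) :* P :+ W :* (J :* P)) refl
             (toℚ i) (toℚ (s ∸ i)) (w i) (power k (s ∸ i)) ⟩
      (toℚ i *ℚ w i) *ℚ power k (s ∸ i) +ℚ w i *ℚ (toℚ (s ∸ i) *ℚ power k (s ∸ i))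
        ≡⟨ cong (λ t → t *ℚ power k (s ∸ i) +ℚ w i *ℚ (toℚ (s ∸ i) *ℚ power k (s ∸ i))) (toℚ*w i 0<i) ⟩
      a i *ℚ power k (s ∸ i) +ℚ w i *ℚ (toℚ (s ∸ i) *ℚ power k (s ∸ i)) ∎

  -- The junk value inv 0 = 0 makes w vanish at 0.
  w-zero : w 0 ≡ 0ℚ
  w-zero = ℚP.*-zeroʳ (a 0)

  -- chain N k u = Σ_{0 < u₁ < ⋯ < u_k < u} w u₁ · (a (u₂-u₁) / u₂) ⋯ (a (u-u_k) / u),
  -- every index ranging over 1..N and the ordering imposed by guards.
  chain : ℕ → ℕ → ℕ → ℚ
  chain N zero    u = w u
  chain N (suc k) u = inv u *ℚ sumTo N (λ v → [ v <? u ]⇒ (a (u ∸ v) *ℚ chain N k v))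

  chain-zero : ∀ N k → chain N k 0 ≡ 0ℚ
  chain-zero N zero    = w-zero
  chain-zero N (suc k) = ℚP.*-zeroˡ (sumTo N (λ v → [ v <? 0 ]⇒ (a (0 ∸ v) *ℚ chain N k v)))

  -- Reindexing a marked convolution by v = u - j turns it into a guarded sum
  -- over v < u, provided the v = 0 term vanishes.
  marked-reverse : ∀ N u (h : ℕ → ℚ) → h 0 ≡ 0ℚ → u ≤ N →
    sumTo u (λ j → a j *ℚ h (u ∸ j)) ≡ sumTo N (λ v → [ v <? u ]⇒ (a (u ∸ v) *ℚ h v))
  marked-reverse N zero h _ _ =
    sym (sum-initial (λ v → v <? 0) 0 N (λ v → a (0 ∸ v) *ℚ h v) z≤n (λ _ ()) (λ { _ (s≤s _) () }))
  marked-reverse N (suc n) h h0≡0 u≤N = begin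
    sumTo (suc n) (λ j → a j *ℚ h (suc n ∸ j))
      ≡⟨ sum-cong (suc n) (λ j _ j≤u → cong (λ t → a t *ℚ h (suc n ∸ j)) (sym (ℕP.m∸[m∸n]≡n j≤u))) ⟩
    sumTo (suc n) (λ j → f (suc n ∸ j))
      ≡⟨ sum-reverse n f ⟩
    f 0 +ℚ sumTo n f
      ≡⟨ cong (_+ℚ sumTo n f) (trans (cong (a (suc n) *ℚ_) h0≡0) (ℚP.*-zeroʳ (a (suc n)))) ⟩
    0ℚ +ℚ sumTo n f
      ≡⟨ ℚP.+-identityˡ _ ⟩
    sumTo n f
      ≡⟨ sym (sum-initial (λ v → v <? suc n) n N f (ℕP.≤-trans (ℕP.n≤1+n n) u≤N)
                (λ _ → ℕ.s≤s⁻¹) (λ _ _ → s≤s)) ⟩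
    sumTo N (λ v → [ v <? suc n ]⇒ f v) ∎
    where
    open ≡-Reasoning
    f : ℕ → ℚ
    f v = a (suc n ∸ v) *ℚ h v

  -- Unfolding the size identity k times: power (k+1) u = (k+1)! · chain N k u.
  power≡chain : ∀ N k u → u ≤ N → power (suc k) u ≡ toℚ (suc k !) *ℚ chain N k u
  power≡chain N zero    zero    _ = sym (trans (ℚP.*-identityˡ (w 0)) w-zero)
  power≡chain N zero    (suc n) _ = trans (power-one n) (sym (ℚP.*-identityˡ (w (suc n))))
  power≡chain N (suc k) zero    _ =
    sym (trans (cong (toℚ (suc (suc k) !) *ℚ_) (chain-zero N (suc k))) (ℚP.*-zeroʳ (toℚ (suc (suc k) !))))
  power≡chain N (suc k) (suc n) u≤N = begin
    power (2+k) u
      ≡⟨ sym (inv-cancel n (power (2+k) u)) ⟩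
    inv u *ℚ (toℚ u *ℚ power (2+k) u)
      ≡⟨ cong (inv u *ℚ_) (size-identity (suc k) u) ⟩
    inv u *ℚ (toℚ (2+k) *ℚ marked (suc k) u)
      ≡⟨ cong (λ t → inv u *ℚ (toℚ (2+k) *ℚ t)) marked≡chain ⟩
    inv u *ℚ (toℚ (2+k) *ℚ (toℚ (suc k !) *ℚ S))
      ≡⟨ solve 4 (λ I A B X → I :* (A :* (B :* X)) := (A :* B) :* (I :* X)) refl
           (inv u) (toℚ (2+k)) (toℚ (suc k !)) S ⟩
    (toℚ (2+k) *ℚ toℚ (suc k !)) *ℚ (inv u *ℚ S)
      ≡⟨ cong (_*ℚ (inv u *ℚ S)) (sym (toℚ-* (2+k) (suc k !))) ⟩
    toℚ (2+k !) *ℚ chain N (suc k) u ∎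
    where
    open ≡-Reasoning
    u 2+k : ℕ
    u   = suc n
    2+k = suc (suc k)
    S : ℚ
    S = sumTo N (λ v → [ v <? u ]⇒ (a (u ∸ v) *ℚ chain N k v))
    marked≡chain : marked (suc k) u ≡ toℚ (suc k !) *ℚ S
    marked≡chain = begin
      sumTo u (λ j → a j *ℚ power (suc k) (u ∸ j))
        ≡⟨ sum-cong u (λ j _ _ → cong (a j *ℚ_) (power≡chain N k (u ∸ j) (ℕP.≤-trans (ℕP.m∸n≤m u j) u≤N))) ⟩
      sumTo u (λ j → a j *ℚ (toℚ (suc k !) *ℚ chain N k (u ∸ j)))
        ≡⟨ sum-cong u (λ j _ _ → solve 3 (λ A C X → A :* (C :* X) := C :* (A :* X)) refl
                                     (a j) (toℚ (suc k !)) (chain N k (u ∸ j))) ⟩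
      sumTo u (λ j → toℚ (suc k !) *ℚ (a j *ℚ chain N k (u ∸ j)))
        ≡⟨ sum-scale u (toℚ (suc k !)) _ ⟩
      toℚ (suc k !) *ℚ sumTo u (λ j → a j *ℚ chain N k (u ∸ j))
        ≡⟨ cong (toℚ (suc k !) *ℚ_) (marked-reverse N u (chain N k) (chain-zero N k) u≤N) ⟩
      toℚ (suc k !) *ℚ S ∎

coprime-complement : ∀ {p N v} → p ∣ N → v ≤ N → Coprime v p → Coprime (N ∸ v) p
coprime-complement {p} {N} {v} p∣N v≤N v⊥p {d} (d∣N-v , d∣p) = v⊥p (d∣v , d∣p)
  where
  d∣v : d ∣ v
  d∣v = ∣m+n∣m⇒∣n (subst (d ∣_) (sym (ℕP.m∸n+n≡m v≤N)) (∣-trans d∣p p∣N)) d∣N-v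

module CoprimeWeights (p : ℕ) where

  e : ℕ → ℚ
  e i = 𝟙 (inP? p i)

  open Harmonic e public

  e-vanish : ¬ p ≡ 1 → ∀ x → p ∣ x → e x ≡ 0ℚ
  e-vanish p≢1 x p∣x with inP? p x
  ... | yes x⊥p = ⊥-elim (p≢1 (x⊥p (p∣x , ∣-refl)))
  ... | no _    = refl

  e-reflect : ∀ {N} → p ∣ N → ∀ v → v ≤ N → e (N ∸ v) ≡ e v
  e-reflect {N} p∣N v v≤N with inP? p (N ∸ v) | inP? p v
  ... | yes _     | yes _   = refl
  ... | no _      | no _    = refl
  ... | yes N-v⊥p | no v⊥̸p =
    ⊥-elim (v⊥̸p (subst (λ t → Coprime t p) (ℕP.m∸[m∸n]≡n v≤N)
                       (coprime-complement p∣N (ℕP.m∸n≤m N v) N-v⊥p)))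
  ... | no N-v⊥̸p | yes v⊥p = ⊥-elim (N-v⊥̸p (coprime-complement p∣N v≤N v⊥p))

  lhs-summand : ∀ N i1 i2 i3 i4 i5 →
    [ ((i1 + i2 + i3 + i4 + i5) ≟ N)
        ×-dec (inP? p i1 ×-dec (inP? p i2 ×-dec (inP? p i3 ×-dec (inP? p i4 ×-dec inP? p i5)))) ]⇒
      inv (i1 * i2 * i3 * i4 * i5)
    ≡ (((w i1 *ℚ w i2) *ℚ w i3) *ℚ w i4) *ℚ (w i5 *ℚ 𝟙 ((i1 + i2 + i3 + i4 + i5) ≟ N))
  lhs-summand N i1 i2 i3 i4 i5 = begin
    _ ≡⟨ unguard ⟩
    𝟙 d *ℚ (e i1 *ℚ (e i2 *ℚ (e i3 *ℚ (e i4 *ℚ (e i5 *ℚ inv (i1 * i2 * i3 * i4 * i5))))))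
      ≡⟨ cong (λ t → 𝟙 d *ℚ (e i1 *ℚ (e i2 *ℚ (e i3 *ℚ (e i4 *ℚ (e i5 *ℚ t)))))) split-inv ⟩
    𝟙 d *ℚ (e i1 *ℚ (e i2 *ℚ (e i3 *ℚ (e i4 *ℚ (e i5 *ℚ ((((inv i1 *ℚ inv i2) *ℚ inv i3) *ℚ inv i4) *ℚ inv i5))))))
      ≡⟨ solve 11 (λ D A1 A2 A3 A4 A5 B1 B2 B3 B4 B5 →
           D :* (A1 :* (A2 :* (A3 :* (A4 :* (A5 :* ((((B1 :* B2) :* B3) :* B4) :* B5))))))
           := ((((A1 :* B1) :* (A2 :* B2)) :* (A3 :* B3)) :* (A4 :* B4)) :* ((A5 :* B5) :* D)) refl
           (𝟙 d) (e i1) (e i2) (e i3) (e i4) (e i5) (inv i1) (inv i2) (inv i3) (inv i4) (inv i5) ⟩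
    (((w i1 *ℚ w i2) *ℚ w i3) *ℚ w i4) *ℚ (w i5 *ℚ 𝟙 d) ∎
    where
    open ≡-Reasoning
    d = (i1 + i2 + i3 + i4 + i5) ≟ N
    c = inP? p
    unguard : [ d ×-dec (c i1 ×-dec (c i2 ×-dec (c i3 ×-dec (c i4 ×-dec c i5)))) ]⇒ inv (i1 * i2 * i3 * i4 * i5)
            ≡ 𝟙 d *ℚ (e i1 *ℚ (e i2 *ℚ (e i3 *ℚ (e i4 *ℚ (e i5 *ℚ inv (i1 * i2 * i3 * i4 * i5))))))
    unguard =
      trans (guard-× d _ _) (cong (𝟙 d *ℚ_)
      (trans (guard-× (c i1) _ _) (cong (e i1 *ℚ_)
      (trans (guard-× (c i2) _ _) (cong (e i2 *ℚ_)
      (trans (guard-× (c i3) _ _) (cong (e i3 *ℚ_)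
      (trans (guard-× (c i4) _ _) (cong (e i4 *ℚ_)
      (guard≡𝟙* (c i5) _))))))))))
    split-inv : inv (i1 * i2 * i3 * i4 * i5) ≡ (((inv i1 *ℚ inv i2) *ℚ inv i3) *ℚ inv i4) *ℚ inv i5
    split-inv =
      trans (inv-* (i1 * i2 * i3 * i4) i5) (cong (_*ℚ inv i5)
      (trans (inv-* (i1 * i2 * i3) i4) (cong (_*ℚ inv i4)
      (trans (inv-* (i1 * i2) i3) (cong (_*ℚ inv i3)
      (inv-* i1 i2))))))

  lhs≡power : ∀ N → lhs p N ≡ power 5 N
  lhs≡power N = begin
    lhs p N
      ≡⟨ sum-cong N (λ i1 _ _ → sum-cong N (λ i2 _ _ → sum-cong N (λ i3 _ _ → sum-cong N (λ i4 _ _ →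
           sum-cong N (λ i5 _ _ → lhs-summand N i1 i2 i3 i4 i5))))) ⟩
    _ ≡⟨ sum-cong N (λ i1 _ _ → sum-cong N (λ i2 _ _ → sum-cong N (λ i3 _ _ → sum-cong N (λ i4 _ _ →
           sum-scale N (((w i1 *ℚ w i2) *ℚ w i3) *ℚ w i4) (λ i5 → w i5 *ℚ 𝟙 ((i1 + i2 + i3 + i4 + i5) ≟ N)))))) ⟩
    _ ≡⟨ sum-cong N (λ i1 _ _ → sum-cong N (λ i2 _ _ → sum-cong N (λ i3 _ _ →
           pull ((w i1 *ℚ w i2) *ℚ w i3) (λ i4 → nested N 1 (i1 + i2 + i3 + i4))))) ⟩
    _ ≡⟨ sum-cong N (λ i1 _ _ → sum-cong N (λ i2 _ _ → pull (w i1 *ℚ w i2) (λ i3 → nested N 2 (i1 + i2 + i3)))) ⟩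
    _ ≡⟨ sum-cong N (λ i1 _ _ → pull (w i1) (λ i2 → nested N 3 (i1 + i2))) ⟩
    nested N 5 0
      ≡⟨ nested≡power N 5 0 z≤n ⟩
    power 5 N ∎
    where
    open ≡-Reasoning
    pull : ∀ x (f : ℕ → ℚ) → sumTo N (λ i → (x *ℚ w i) *ℚ f i) ≡ x *ℚ sumTo N (λ i → w i *ℚ f i)
    pull x f = trans (sum-cong N (λ i _ _ → ℚP.*-assoc x (w i) (f i))) (sum-scale N x _)

  link : ℕ → ℕ → ℚ
  link u v = [ v <? u ]⇒ (e (u ∸ v) *ℚ inv v)

  -- The right-hand summand, factorised as produced by unfolding chain N 3.
  rhs-term : ℕ → ℕ → ℕ → ℕ → ℚ
  rhs-term u4 u3 u2 u1 =
    (e u4 *ℚ inv u4) *ℚ (link u4 u3 *ℚ (link u3 u2 *ℚ [ u1 <? u2 ]⇒ (e (u2 ∸ u1) *ℚ w u1)))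

  rhs-summand : ∀ u1 u2 u3 u4 →
    [ (u1 <? u2) ×-dec ((u2 <? u3) ×-dec ((u3 <? u4) ×-dec
        (inP? p u1 ×-dec (inP? p u4 ×-dec (inP? p (u2 ∸ u1) ×-dec
          (inP? p (u3 ∸ u2) ×-dec inP? p (u4 ∸ u3))))))) ]⇒
      inv (u1 * u2 * u3 * u4)
    ≡ rhs-term u4 u3 u2 u1
  rhs-summand u1 u2 u3 u4 = begin
    _ ≡⟨ unguard ⟩
    o12 *ℚ (o23 *ℚ (o34 *ℚ (e u1 *ℚ (e u4 *ℚ (e21 *ℚ (e32 *ℚ (e43 *ℚ inv (u1 * u2 * u3 * u4))))))))
      ≡⟨ cong (λ t → o12 *ℚ (o23 *ℚ (o34 *ℚ (e u1 *ℚ (e u4 *ℚ (e21 *ℚ (e32 *ℚ (e43 *ℚ t)))))))) split-inv ⟩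
    o12 *ℚ (o23 *ℚ (o34 *ℚ (e u1 *ℚ (e u4 *ℚ (e21 *ℚ (e32 *ℚ (e43 *ℚ (((inv u1 *ℚ inv u2) *ℚ inv u3) *ℚ inv u4))))))))
      ≡⟨ solve 12 (λ O12 O23 O34 E1 E4 E21 E32 E43 V1 V2 V3 V4 →
           O12 :* (O23 :* (O34 :* (E1 :* (E4 :* (E21 :* (E32 :* (E43 :* (((V1 :* V2) :* V3) :* V4))))))))
           := (E4 :* V4) :* ((O34 :* (E43 :* V3)) :* ((O23 :* (E32 :* V2)) :* (O12 :* (E21 :* (E1 :* V1))))))
           refl o12 o23 o34 (e u1) (e u4) e21 e32 e43 (inv u1) (inv u2) (inv u3) (inv u4) ⟩
    (e u4 *ℚ inv u4) *ℚ ((o34 *ℚ (e43 *ℚ inv u3)) *ℚ ((o23 *ℚ (e32 *ℚ inv u2)) *ℚ (o12 *ℚ (e21 *ℚ w u1))))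
      ≡⟨ sym (cong₂ (λ x y → (e u4 *ℚ inv u4) *ℚ (x *ℚ y))
                    (guard≡𝟙* (u3 <? u4) _)
                    (cong₂ _*ℚ_ (guard≡𝟙* (u2 <? u3) _) (guard≡𝟙* (u1 <? u2) _))) ⟩
    rhs-term u4 u3 u2 u1 ∎
    where
    open ≡-Reasoning
    c = inP? p
    o12 = 𝟙 (u1 <? u2)
    o23 = 𝟙 (u2 <? u3)
    o34 = 𝟙 (u3 <? u4)
    e21 = e (u2 ∸ u1)
    e32 = e (u3 ∸ u2)
    e43 = e (u4 ∸ u3)
    unguard :
      [ (u1 <? u2) ×-dec ((u2 <? u3) ×-dec ((u3 <? u4) ×-dec
          (c u1 ×-dec (c u4 ×-dec (c (u2 ∸ u1) ×-dec (c (u3 ∸ u2) ×-dec c (u4 ∸ u3))))))) ]⇒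
        inv (u1 * u2 * u3 * u4)
      ≡ o12 *ℚ (o23 *ℚ (o34 *ℚ (e u1 *ℚ (e u4 *ℚ (e21 *ℚ (e32 *ℚ (e43 *ℚ inv (u1 * u2 * u3 * u4))))))))
    unguard =
      trans (guard-× (u1 <? u2) _ _) (cong (o12 *ℚ_)
      (trans (guard-× (u2 <? u3) _ _) (cong (o23 *ℚ_)
      (trans (guard-× (u3 <? u4) _ _) (cong (o34 *ℚ_)
      (trans (guard-× (c u1) _ _) (cong (e u1 *ℚ_)
      (trans (guard-× (c u4) _ _) (cong (e u4 *ℚ_)
      (trans (guard-× (c (u2 ∸ u1)) _ _) (cong (e21 *ℚ_)
      (trans (guard-× (c (u3 ∸ u2)) _ _) (cong (e32 *ℚ_)
      (guard≡𝟙* (c (u4 ∸ u3)) _))))))))))))))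
    split-inv : inv (u1 * u2 * u3 * u4) ≡ ((inv u1 *ℚ inv u2) *ℚ inv u3) *ℚ inv u4
    split-inv =
      trans (inv-* (u1 * u2 * u3) u4) (cong (_*ℚ inv u4)
      (trans (inv-* (u1 * u2) u3) (cong (_*ℚ inv u3)
      (inv-* u1 u2))))

  chain-expand : ∀ N u4 → e u4 *ℚ chain N 3 u4 ≡
    sumTo N (λ u3 → sumTo N (λ u2 → sumTo N (λ u1 → rhs-term u4 u3 u2 u1)))
  chain-expand N u4 = begin
    e u4 *ℚ (inv u4 *ℚ sumTo N (λ u3 → [ u3 <? u4 ]⇒ (e (u4 ∸ u3) *ℚ chain N 2 u3)))
      ≡⟨ trans (sym (ℚP.*-assoc (e u4) (inv u4) _)) (sym (sum-scale N (e u4 *ℚ inv u4) _)) ⟩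
    sumTo N (λ u3 → (e u4 *ℚ inv u4) *ℚ [ u3 <? u4 ]⇒ (e (u4 ∸ u3) *ℚ chain N 2 u3))
      ≡⟨ sum-cong N (λ u3 _ _ → cong ((e u4 *ℚ inv u4) *ℚ_)
           (trans (guard-into-sum (u3 <? u4) N (e (u4 ∸ u3)) (inv u3) _)
                  (sum-cong N (λ u2 _ _ → cong (link u4 u3 *ℚ_)
                     (guard-into-sum (u2 <? u3) N (e (u3 ∸ u2)) (inv u2) _))))) ⟩
    sumTo N (λ u3 → (e u4 *ℚ inv u4) *ℚ sumTo N (λ u2 → link u4 u3 *ℚ
                      sumTo N (λ u1 → link u3 u2 *ℚ [ u1 <? u2 ]⇒ (e (u2 ∸ u1) *ℚ w u1))))
      ≡⟨ sum-cong N (λ u3 _ _ → trans (sym (sum-scale N (e u4 *ℚ inv u4) _))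
                                      (sum-cong N (λ u2 _ _ → scale-into-sum N (e u4 *ℚ inv u4) (link u4 u3)
                                         (λ u1 → link u3 u2 *ℚ [ u1 <? u2 ]⇒ (e (u2 ∸ u1) *ℚ w u1))))) ⟩
    sumTo N (λ u3 → sumTo N (λ u2 → sumTo N (λ u1 → rhs-term u4 u3 u2 u1))) ∎
    where open ≡-Reasoning

  rhs≡chain-sum : ∀ N → rhsSum p N ≡ sumTo N (λ u4 → e u4 *ℚ chain N 3 u4)
  rhs≡chain-sum N = begin
    rhsSum p N
      ≡⟨ sum-cong N (λ u1 _ _ → sum-cong N (λ u2 _ _ → sum-cong N (λ u3 _ _ → sum-cong N (λ u4 _ _ →
           rhs-summand u1 u2 u3 u4)))) ⟩
    sumTo N (λ u1 → sumTo N (λ u2 → sumTo N (λ u3 → sumTo N (λ u4 → rhs-term u4 u3 u2 u1))))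
      ≡⟨ sum-reverse-order N (λ u1 u2 u3 u4 → rhs-term u4 u3 u2 u1) ⟩
    sumTo N (λ u4 → sumTo N (λ u3 → sumTo N (λ u2 → sumTo N (λ u1 → rhs-term u4 u3 u2 u1))))
      ≡⟨ sym (sum-cong N (λ u4 _ _ → chain-expand N u4)) ⟩
    sumTo N (λ u4 → e u4 *ℚ chain N 3 u4) ∎
    where open ≡-Reasoning

  -- When p ∣ N the last link e (N - u₄) may be replaced by e u₄, turning
  -- chain N 4 N into the right-hand side.
  chain-top≡rhs : ¬ p ≡ 1 → ∀ N → p ∣ N → chain N 4 N ≡ inv N *ℚ rhsSum p N
  chain-top≡rhs p≢1 N p∣N =
    cong (inv N *ℚ_) (trans (sum-cong N reflect) (sym (rhs≡chain-sum N)))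
    where
    reflect : ∀ v → 0 < v → v ≤ N → [ v <? N ]⇒ (e (N ∸ v) *ℚ chain N 3 v) ≡ e v *ℚ chain N 3 v
    reflect v _ v≤N with v <? N
    ... | yes _   = cong (_*ℚ chain N 3 v) (e-reflect p∣N v v≤N)
    ... | no v≮N  rewrite ℕP.≤-antisym v≤N (ℕP.≮⇒≥ v≮N) =
      sym (trans (cong (_*ℚ chain N 3 N) (e-vanish p≢1 N p∣N)) (ℚP.*-zeroˡ (chain N 3 N)))

lemma9 : (p r m : ℕ) → Prime p → 5 < p → 1 ≤ r → 1 ≤ m →
    lhs p (m * p ^ r) ≡ ((+ 120 / 1) *ℚ inv (m * p ^ r)) *ℚ rhsSum p (m * p ^ r)
lemma9 p zero    m _ _   () _
lemma9 p (suc r) m _ 5<p _  _ = begin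
  lhs p N                               ≡⟨ lhs≡power N ⟩
  power 5 N                             ≡⟨ power≡chain N 4 N ℕP.≤-refl ⟩
  toℚ (5 !) *ℚ chain N 4 N              ≡⟨ cong (toℚ (5 !) *ℚ_) (chain-top≡rhs p≢1 N p∣N) ⟩
  toℚ (5 !) *ℚ (inv N *ℚ rhsSum p N)    ≡⟨ sym (ℚP.*-assoc (toℚ (5 !)) (inv N) (rhsSum p N)) ⟩
  (toℚ (5 !) *ℚ inv N) *ℚ rhsSum p N    ∎
  where
  open ≡-Reasoning
  open CoprimeWeights p
  N : ℕ
  N = m * p ^ suc r
  p≢1 : ¬ p ≡ 1
  p≢1 refl = ℕP.<⇒≱ 5<p (s≤s z≤n)
  p∣N : p ∣ N
  p∣N = ∣n⇒∣m*n m (m∣m*n (p ^ r))
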